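{- Let $G$ be a labeled graph and $t$ a substitution tree of $G$. Then $t$ can be transformed into an expanded tree of $G$ by applying successive inflations.
   Context: A substitution tree is a rooted non-plane tree whose leaves are labeled bijectively by $\{1,\dots,n\}$ and whose internal nodes are decorated either by $\oplus$ or $\ominus$ (linear nodes, with at least 2 children) or by a labeled graph $H$ with $|H|\ge2$ (non-linear nodes, with exactly $|H|$ children). The children subtrees of a node are ordered by their minimal leaf label. $\mathrm{Graph}(t)$ is defined recursively: a single leaf labeled $j$ gives the one-vertex graph labeled $j$; otherwise, if the root is decorated by $H$ (with $\oplus$/$\ominus$ read as the complete/edgeless graph on the number of children) and $t_1,\dots,t_{k}$ are its ordered subtrees, $\mathrm{Graph}(t)=H[\mathrm{Graph}(t_1),\dots,\mathrm{Graph}(t_k)]$, where $H[G_1,\dots,G_k]$ keeps edges inside each $G_i$ and joins a vertex of $G_i$ to a vertex of $G_j$ ($i\neq j$) iff vertices $i,j$ are adjacent in $H$. $t$ is a substitution tree of $G$ if $\mathrm{Graph}(t)=G$. A graph is prime if it has at least 3 vertices and its only modules (vertex sets $M$ such that each outside vertex is adjacent to all or none of $M$) are trivial. An expanded tree of $G$ is a substitution tree of $G$ whose non-linear nodes are decorated by prime graphs and whose linear nodes all have exactly two children. The inflation of a substitution tree $t$ at an internal node $\mathfrak n$ with a substitution tree $\tau$ of the decoration of $\mathfrak n$ (seen as a graph) is obtained by replacing $\mathfrak n$ by $\tau$ and then replacing, for each $j$, the $j$-th leaf of $\tau$ by the $j$-th subtree of $\mathfrak n$. -}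

module Defs where

open import Data.Nat using (ℕ; zero; suc; _≤_; _<_; _⊓_; _≡ᵇ_)
open import Data.Fin as Fin using (Fin; zero; suc; toℕ)
open import Data.Fin.Properties using () renaming (_≟_ to _≟ᶠ_)
open import Data.Bool using (Bool; true; false; if_then_else_)
open import Data.List using (List; []; _∷_; _++_; foldr; upTo)
open import Data.Bool.ListAction using (any)
open import Data.List.Relation.Binary.Permutation.Propositional using (_↭_)
open import Data.Vec using (Vec; []; _∷_; lookup; _[_]≔_)
open import Data.Vec.Relation.Unary.All using (All)
open import Data.Maybe using (Maybe; just; nothing)
import Data.Maybe as Maybe
open import Data.Product using (Σ; _×_; ∃)
open import Data.Sum using (_⊎_)
open import Relation.Nullary.Decidable using (⌊_⌋)
open import Relation.Binary.PropositionalEquality using (_≡_; refl; sym)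
open import Relation.Nullary using (yes; no)
open import Data.Empty using (⊥-elim)
open import Relation.Binary.Construct.Closure.ReflexiveTransitive using (Star)

-- Labeled (simple, undirected) graphs on the vertex set {0,…,n-1}
-- (the paper's {1,…,n}, shifted by one).

record LGraph (n : ℕ) : Set where
  field
    adj    : Fin n → Fin n → Bool
    adj-sym    : ∀ i j → adj i j ≡ adj j i
    adj-irrefl : ∀ i → adj i i ≡ false
open LGraph public

IsModule : ∀ {n} → LGraph n → (Fin n → Bool) → Set
IsModule G M = ∀ x → M x ≡ false → ∀ y z → M y ≡ true → M z ≡ true →
               adj G x y ≡ adj G x z

TrivialSet : ∀ {n} → (Fin n → Bool) → Set
TrivialSet {n} M =
  (∀ x → M x ≡ false)
  ⊎ (∃ λ (v : Fin n) → M v ≡ true × (∀ y → M y ≡ true → y ≡ v))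
  ⊎ (∀ x → M x ≡ true)

Prime : ∀ {n} → LGraph n → Set
Prime {n} G = 3 ≤ n × (∀ M → IsModule G M → TrivialSet M)

complete : (k : ℕ) → LGraph k
complete k = record
  { adj = λ i j → if ⌊ i ≟ᶠ j ⌋ then false else true
  ; adj-sym = sym′ ; adj-irrefl = irr }
  where
  sym′ : ∀ i j → (if ⌊ i ≟ᶠ j ⌋ then false else true) ≡ (if ⌊ j ≟ᶠ i ⌋ then false else true)
  sym′ i j with i ≟ᶠ j | j ≟ᶠ i
  ... | yes _ | yes _ = refl
  ... | no _  | no _  = refl
  ... | yes p | no ¬q = ⊥-elim (¬q (sym p))
  ... | no ¬p | yes q = ⊥-elim (¬p (sym q))
  irr : ∀ i → (if ⌊ i ≟ᶠ i ⌋ then false else true) ≡ false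
  irr i with i ≟ᶠ i
  ... | yes _ = refl
  ... | no ¬p = ⊥-elim (¬p refl)

edgeless : (k : ℕ) → LGraph k
edgeless k = record { adj = λ _ _ → false ; adj-sym = λ _ _ → refl ; adj-irrefl = λ _ → refl }

-- The children are stored
-- in a vector; well-formedness (WF) demands that they are listed in
-- increasing order of their minimal leaf label (the canonical order of
-- the paper's non-plane tree), and that every node has ≥ 2 children.

data Deco (k : ℕ) : Set where
  ⊕  : Deco k
  ⊖  : Deco k
  gr : LGraph k → Deco k

decoGraph : ∀ {k} → Deco k → LGraph k
decoGraph {k} ⊕ = complete k
decoGraph {k} ⊖ = edgeless k
decoGraph (gr H) = H

data Tree : Set where
  leaf : ℕ → Tree
  node : ∀ {k} → Deco k → Vec Tree k → Tree

mutual
  leaves : Tree → List ℕ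
  leaves (leaf a) = a ∷ []
  leaves (node d cs) = leavesV cs

  leavesV : ∀ {k} → Vec Tree k → List ℕ
  leavesV [] = []
  leavesV (c ∷ cs) = leaves c ++ leavesV cs

minList : List ℕ → ℕ
minList [] = 0
minList (x ∷ xs) = foldr _⊓_ x xs

minLeaf : Tree → ℕ
minLeaf t = minList (leaves t)

_∈ᵇ_ : ℕ → List ℕ → Bool
a ∈ᵇ xs = any (λ x → x ≡ᵇ a) xs

locate : ∀ {k} → Vec Tree k → ℕ → Maybe (Fin k)
locate [] a = nothing
locate (c ∷ cs) a = if a ∈ᵇ leaves c then just zero else Maybe.map suc (locate cs a)

combine : ∀ {k} → LGraph k → Maybe (Fin k) → Maybe (Fin k) → Bool → Bool
combine H (just i) (just j) inner = if ⌊ i ≟ᶠ j ⌋ then inner else adj H i j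
combine H _ _ _ = false

-- Adjacency in Graph(t), between leaf labels a and b:
-- Graph(node H [t₁,…,t_k]) = H[Graph(t₁),…,Graph(t_k)].
mutual
  treeAdj : Tree → ℕ → ℕ → Bool
  treeAdj (leaf _) a b = false
  treeAdj (node d cs) a b =
    combine (decoGraph d) (locate cs a) (locate cs b) (innerAdj cs a b)

  innerAdj : ∀ {k} → Vec Tree k → ℕ → ℕ → Bool
  innerAdj [] a b = false
  innerAdj (c ∷ cs) a b =
    if a ∈ᵇ leaves c then (if b ∈ᵇ leaves c then treeAdj c a b else false)
    else innerAdj cs a b

SortedChildren : ∀ {k} → Vec Tree k → Set
SortedChildren {k} cs =
  ∀ (i j : Fin k) → i Fin.< j → minLeaf (lookup cs i) < minLeaf (lookup cs j)

data WF : Tree → Set where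
  wf-leaf : ∀ a → WF (leaf a)
  wf-node : ∀ {k} (d : Deco k) (cs : Vec Tree k) →
            2 ≤ k → SortedChildren cs → All WF cs → WF (node d cs)

SubstTreeOf : Tree → ∀ {n} → LGraph n → Set
SubstTreeOf t {n} G =
  WF t × leaves t ↭ upTo n ×
  (∀ (i j : Fin n) → treeAdj t (toℕ i) (toℕ j) ≡ adj G i j)

data ExpandedShape : Tree → Set where
  ex-leaf  : ∀ a → ExpandedShape (leaf a)
  ex-plus  : (cs : Vec Tree 2) → All ExpandedShape cs → ExpandedShape (node ⊕ cs)
  ex-minus : (cs : Vec Tree 2) → All ExpandedShape cs → ExpandedShape (node ⊖ cs)
  ex-prime : ∀ {k} (H : LGraph k) (cs : Vec Tree k) → Prime H →
             All ExpandedShape cs → ExpandedShape (node (gr H) cs)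

ExpandedTreeOf : Tree → ∀ {n} → LGraph n → Set
ExpandedTreeOf t G = SubstTreeOf t G × ExpandedShape t

lookupD : ∀ {A : Set} {k} → Vec A k → ℕ → A → A
lookupD [] _ d = d
lookupD (x ∷ xs) zero d = x
lookupD (x ∷ xs) (suc n) d = lookupD xs n d

mutual
  graft : ∀ {k} → Tree → Vec Tree k → Tree
  graft (leaf j) cs = lookupD cs j (leaf j)
  graft (node d ts) cs = node d (graftV ts cs)

  graftV : ∀ {k m} → Vec Tree m → Vec Tree k → Vec Tree m
  graftV [] cs = []
  graftV (t ∷ ts) cs = graft t cs ∷ graftV ts cs

data Inflation : Tree → Tree → Set where
  here  : ∀ {k} (d : Deco k) (cs : Vec Tree k) (τ : Tree) →
          SubstTreeOf τ (decoGraph d) →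
          Inflation (node d cs) (graft τ cs)
  under : ∀ {k} (d : Deco k) (cs : Vec Tree k) (i : Fin k) (c′ : Tree) →
          Inflation (lookup cs i) c′ →
          Inflation (node d cs) (node d (cs [ i ]≔ c′))

Inflations : Tree → Tree → Set
Inflations = Star Inflation

-- Expand the tree bottom-up. Once the children of a node are expanded, look at its decoration H.
-- If H has a non-trivial module M, inflate the node by quotient[…, factor, …], where factor is
-- H restricted to M and quotient is H with M collapsed to its least vertex; both have fewer
-- vertices than H and are expanded recursively. Otherwise H is prime, or H has two vertices and
-- one inflation turns it into ⊕ or ⊖; a linear node with three or more children always has a
-- non-trivial module. Trees are compared through their leaf set and their graph (_≈_), which
-- inflations preserve, so the result is still a substitution tree of G.

module Submission where

open import Data.Bool using (Bool; true; false; T; if_then_else_)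
open import Data.Bool.Properties using (¬-not; T-≡) renaming (_≟_ to _≟ᵇ_)
open import Data.Empty using (⊥; ⊥-elim)
open import Data.Fin as Fin using (Fin; zero; suc; toℕ)
import Data.Fin.Properties as Fin
open import Data.Fin.Subset.Properties using (anySubset?)
open import Data.List using (List; []; _∷_; _++_; foldr; upTo)
open import Data.List.Membership.Propositional using (_∈_; _∉_)
open import Data.List.Membership.Propositional.Properties
  using (∈-++⁺ˡ; ∈-++⁺ʳ; ∈-++⁻; ∈-upTo⁺; ∈-upTo⁻)
open import Data.List.Membership.Propositional.Properties.WithK using (unique∧set⇒bag)
open import Data.List.Relation.Binary.BagAndSetEquality using (∼bag⇒↭)
open import Data.List.Relation.Binary.Disjoint.Propositional using (Disjoint)
open import Data.List.Relation.Binary.Permutation.Propositional using (↭-sym; ↭⇒↭ₛ)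
open import Data.List.Relation.Binary.Permutation.Propositional.Properties using (∈-resp-↭)
import Data.List.Relation.Unary.All as List
open import Data.List.Relation.Unary.AllPairs using ([]; _∷_)
import Data.List.Relation.Unary.Any as Any
open import Data.List.Relation.Unary.Any using (here; there)
open import Data.List.Relation.Unary.Any.Properties using (any⁺; any⁻)
open import Data.List.Relation.Unary.Unique.Propositional using (Unique)
import Data.List.Relation.Unary.Unique.Propositional.Properties as Unique
open import Data.Maybe using (just; nothing)
import Data.Maybe as Maybe
open import Data.Nat as ℕ using (ℕ; zero; suc; _≤_; _<_; _⊓_; z≤n; s≤s)
open import Data.Nat.Induction using (<-rec)
import Data.Nat.Properties as ℕ
open import Data.List.Membership.DecPropositional ℕ._≟_ using (_∈?_)
open import Data.Product using (Σ; _×_; _,_; proj₁; proj₂; ∃)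
open import Data.Sum using (_⊎_; inj₁; inj₂)
open import Data.Vec using (Vec; []; _∷_; lookup; _[_]≔_; tabulate)
import Data.Vec.Properties as Vec
import Data.Vec.Relation.Binary.Pointwise.Inductive as Pointwise
open Pointwise using (Pointwise; []; _∷_)
open import Data.Vec.Relation.Unary.All as All using (All; []; _∷_)
import Data.Vec.Relation.Unary.All.Properties as Allₚ
open import Function using (_∘_; flip; case_of_)
open import Function.Bundles using (Equivalence; mk⇔)
open import Relation.Binary.Construct.Closure.ReflexiveTransitive using (Star; ε; _◅_; _◅◅_)
import Relation.Binary.Construct.Closure.ReflexiveTransitive as Star
open import Relation.Binary.Definitions using (tri<; tri≈; tri>)
open import Relation.Binary.PropositionalEquality
import Data.List.Relation.Binary.Permutation.Setoid.Properties (setoid ℕ) as Perm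
open import Relation.Nullary using (yes; no; ¬_; Dec)
open import Relation.Nullary.Decidable using (map′; _×-dec_; _→-dec_; _⊎-dec_; ¬?; ⌊_⌋)

open import Defs

∈ᵇ⇒∈ : ∀ {a} xs → T (a ∈ᵇ xs) → a ∈ xs
∈ᵇ⇒∈ xs p = Any.map (λ {x} → sym ∘ ℕ.≡ᵇ⇒≡ x _) (any⁻ _ xs p)

∈⇒∈ᵇ : ∀ {a xs} → a ∈ xs → a ∈ᵇ xs ≡ true
∈⇒∈ᵇ {a} p = Equivalence.to T-≡ (any⁺ _ (Any.map (λ {x} e → ℕ.≡⇒≡ᵇ x a (sym e)) p))

∉⇒∈ᵇ : ∀ {a} xs → a ∉ xs → a ∈ᵇ xs ≡ false
∉⇒∈ᵇ xs a∉xs = ¬-not (a∉xs ∘ ∈ᵇ⇒∈ xs ∘ Equivalence.from T-≡)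

∈ᵇ-cong : ∀ {a xs ys} → (a ∈ xs → a ∈ ys) → (a ∈ ys → a ∈ xs) → a ∈ᵇ xs ≡ a ∈ᵇ ys
∈ᵇ-cong {a} {xs} {ys} to from with a ∈? xs
... | yes a∈xs = trans (∈⇒∈ᵇ a∈xs) (sym (∈⇒∈ᵇ (to a∈xs)))
... | no a∉xs = trans (∉⇒∈ᵇ xs a∉xs) (sym (∉⇒∈ᵇ ys (a∉xs ∘ from)))

∈-leavesV⁺ : ∀ {k} (cs : Vec Tree k) i {x} → x ∈ leaves (lookup cs i) → x ∈ leavesV cs
∈-leavesV⁺ (c ∷ cs) zero p = ∈-++⁺ˡ p
∈-leavesV⁺ (c ∷ cs) (suc i) p = ∈-++⁺ʳ (leaves c) (∈-leavesV⁺ cs i p)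

∈-leavesV⁻ : ∀ {k} (cs : Vec Tree k) {x} → x ∈ leavesV cs → ∃ λ i → x ∈ leaves (lookup cs i)
∈-leavesV⁻ (c ∷ cs) p with ∈-++⁻ (leaves c) p
... | inj₁ q = zero , q
... | inj₂ q = let i , r = ∈-leavesV⁻ cs q in suc i , r

∈-leaves-≡ : ∀ {t t′ x} → t ≡ t′ → x ∈ leaves t → x ∈ leaves t′
∈-leaves-≡ refl p = p

DisjointChildren : ∀ {k} → Vec Tree k → Set
DisjointChildren {k} cs =
  ∀ (i j : Fin k) {x} → x ∈ leaves (lookup cs i) → x ∈ leaves (lookup cs j) → i ≡ j

DisjointChildren-tail : ∀ {k c} {cs : Vec Tree k} → DisjointChildren (c ∷ cs) → DisjointChildren cs
DisjointChildren-tail D i j p q = Fin.suc-injective (D (suc i) (suc j) p q)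

Unique-++⁻ : ∀ (xs : List ℕ) {ys} → Unique (xs ++ ys) → Unique xs × Unique ys × Disjoint xs ys
Unique-++⁻ [] u = [] , u , λ ()
Unique-++⁻ (x ∷ xs) (x∉ ∷ u) with Unique-++⁻ xs u
... | uxs , uys , disj =
  List.tabulate (List.lookup x∉ ∘ ∈-++⁺ˡ) ∷ uxs , uys ,
  λ { (here refl , q) → List.lookup x∉ (∈-++⁺ʳ xs q) refl ; (there p , q) → disj (p , q) }

Unique-leavesV⁻ : ∀ {k} (cs : Vec Tree k) → Unique (leavesV cs) →
                  (∀ i → Unique (leaves (lookup cs i))) × DisjointChildren cs
Unique-leavesV⁻ [] u = (λ ()) , λ ()
Unique-leavesV⁻ (c ∷ cs) u with Unique-++⁻ (leaves c) u
... | uc , ucs , disj with Unique-leavesV⁻ cs ucs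
... | us , D = (λ { zero → uc ; (suc i) → us i }) , D′
  where
  D′ : DisjointChildren (c ∷ cs)
  D′ zero    zero    p q = refl
  D′ zero    (suc j) p q = ⊥-elim (disj (p , ∈-leavesV⁺ cs j q))
  D′ (suc i) zero    p q = ⊥-elim (disj (q , ∈-leavesV⁺ cs i p))
  D′ (suc i) (suc j) p q = cong suc (D i j p q)

Unique-leavesV⁺ : ∀ {k} (cs : Vec Tree k) → (∀ i → Unique (leaves (lookup cs i))) →
                  DisjointChildren cs → Unique (leavesV cs)
Unique-leavesV⁺ [] us D = []
Unique-leavesV⁺ (c ∷ cs) us D =
  Unique.++⁺ (us zero) (Unique-leavesV⁺ cs (us ∘ suc) (DisjointChildren-tail D)) disj
  where
  disj : Disjoint (leaves c) (leavesV cs)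
  disj (p , q) with i , r ← ∈-leavesV⁻ cs q with () ← D zero (suc i) p r

locate-∈ : ∀ {k} (cs : Vec Tree k) → DisjointChildren cs → ∀ i {a} →
           a ∈ leaves (lookup cs i) → locate cs a ≡ just i
locate-∈ (c ∷ cs) D zero p rewrite ∈⇒∈ᵇ p = refl
locate-∈ (c ∷ cs) D (suc i) p
  rewrite ∉⇒∈ᵇ (leaves c) (λ q → Fin.0≢1+n (D zero (suc i) q p))
  = cong (Maybe.map suc) (locate-∈ cs (DisjointChildren-tail D) i p)

locate-∉ : ∀ {k} (cs : Vec Tree k) {a} → a ∉ leavesV cs → locate cs a ≡ nothing
locate-∉ [] a∉ = refl
locate-∉ (c ∷ cs) a∉
  rewrite ∉⇒∈ᵇ (leaves c) (a∉ ∘ ∈-++⁺ˡ)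
  = cong (Maybe.map suc) (locate-∉ cs (a∉ ∘ ∈-++⁺ʳ (leaves c)))

innerAdj-∈ : ∀ {k} (cs : Vec Tree k) → DisjointChildren cs → ∀ i {a b} →
             a ∈ leaves (lookup cs i) → b ∈ leaves (lookup cs i) →
             innerAdj cs a b ≡ treeAdj (lookup cs i) a b
innerAdj-∈ (c ∷ cs) D zero p q rewrite ∈⇒∈ᵇ p | ∈⇒∈ᵇ q = refl
innerAdj-∈ (c ∷ cs) D (suc i) p q
  rewrite ∉⇒∈ᵇ (leaves c) (λ r → Fin.0≢1+n (D zero (suc i) r p))
  = innerAdj-∈ cs (DisjointChildren-tail D) i p q

treeAdj-∉ˡ : ∀ t {a} b → a ∉ leaves t → treeAdj t a b ≡ false
treeAdj-∉ˡ (leaf x) b a∉ = refl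
treeAdj-∉ˡ (node d cs) b a∉ rewrite locate-∉ cs a∉ = refl

treeAdj-∉ʳ : ∀ t a {b} → b ∉ leaves t → treeAdj t a b ≡ false
treeAdj-∉ʳ (leaf x) a b∉ = refl
treeAdj-∉ʳ (node d cs) a b∉ rewrite locate-∉ cs b∉ with locate cs a
... | just _ = refl
... | nothing = refl

treeAdj-node-same : ∀ {k} (d : Deco k) (cs : Vec Tree k) → DisjointChildren cs → ∀ i {a b} →
                    a ∈ leaves (lookup cs i) → b ∈ leaves (lookup cs i) →
                    treeAdj (node d cs) a b ≡ treeAdj (lookup cs i) a b
treeAdj-node-same d cs D i p q rewrite locate-∈ cs D i p | locate-∈ cs D i q with i Fin.≟ i
... | yes _ = innerAdj-∈ cs D i p q
... | no i≢i = ⊥-elim (i≢i refl)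

treeAdj-node-diff : ∀ {k} (d : Deco k) (cs : Vec Tree k) → DisjointChildren cs → ∀ {i j a b} →
                    a ∈ leaves (lookup cs i) → b ∈ leaves (lookup cs j) → i ≢ j →
                    treeAdj (node d cs) a b ≡ adj (decoGraph d) i j
treeAdj-node-diff d cs D {i} {j} p q i≢j rewrite locate-∈ cs D i p | locate-∈ cs D j q with i Fin.≟ j
... | yes i≡j = ⊥-elim (i≢j i≡j)
... | no _ = refl

-- Trees with the same leaves and the same graph

record _≈_ (t u : Tree) : Set where
  field
    leaves⊆ : ∀ {x} → x ∈ leaves t → x ∈ leaves u
    leaves⊇ : ∀ {x} → x ∈ leaves u → x ∈ leaves t
    treeAdj≡ : ∀ a b → treeAdj t a b ≡ treeAdj u a b
open _≈_

≈-refl : ∀ {t} → t ≈ t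
≈-refl = record { leaves⊆ = λ p → p ; leaves⊇ = λ p → p ; treeAdj≡ = λ _ _ → refl }

≈-reflexive : ∀ {t u} → t ≡ u → t ≈ u
≈-reflexive refl = ≈-refl

≈-trans : ∀ {t u v} → t ≈ u → u ≈ v → t ≈ v
≈-trans t≈u u≈v = record
  { leaves⊆ = leaves⊆ u≈v ∘ leaves⊆ t≈u
  ; leaves⊇ = leaves⊇ t≈u ∘ leaves⊇ u≈v
  ; treeAdj≡ = λ a b → trans (treeAdj≡ t≈u a b) (treeAdj≡ u≈v a b)
  }

_≈ᵥ_ : ∀ {k} → Vec Tree k → Vec Tree k → Set
_≈ᵥ_ = Pointwise _≈_

locate-cong : ∀ {k} {cs cs′ : Vec Tree k} → cs ≈ᵥ cs′ → ∀ a → locate cs a ≡ locate cs′ a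
locate-cong [] a = refl
locate-cong (c≈c′ ∷ cs≈cs′) a =
  cong₂ (λ b r → if b then just zero else Maybe.map suc r)
    (∈ᵇ-cong (leaves⊆ c≈c′) (leaves⊇ c≈c′)) (locate-cong cs≈cs′ a)

innerAdj-cong : ∀ {k} {cs cs′ : Vec Tree k} → cs ≈ᵥ cs′ → ∀ a b →
                innerAdj cs a b ≡ innerAdj cs′ a b
innerAdj-cong [] a b = refl
innerAdj-cong {cs = c ∷ _} {c′ ∷ _} (c≈c′ ∷ cs≈cs′) a b
  rewrite ∈ᵇ-cong {a} (leaves⊆ c≈c′) (leaves⊇ c≈c′)
        | ∈ᵇ-cong {b} (leaves⊆ c≈c′) (leaves⊇ c≈c′)
        | treeAdj≡ c≈c′ a b | innerAdj-cong cs≈cs′ a b = refl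

node-cong : ∀ {k} (d : Deco k) {cs cs′ : Vec Tree k} → cs ≈ᵥ cs′ → node d cs ≈ node d cs′
node-cong d {cs} {cs′} cs≈cs′ = record
  { leaves⊆ = λ p → let i , q = ∈-leavesV⁻ cs p in ∈-leavesV⁺ cs′ i (leaves⊆ (≈ᵢ i) q)
  ; leaves⊇ = λ p → let i , q = ∈-leavesV⁻ cs′ p in ∈-leavesV⁺ cs i (leaves⊇ (≈ᵢ i) q)
  ; treeAdj≡ = λ a b → cong₃ (combine (decoGraph d))
                         (locate-cong cs≈cs′ a) (locate-cong cs≈cs′ b) (innerAdj-cong cs≈cs′ a b)
  }
  where
  ≈ᵢ : ∀ i → lookup cs i ≈ lookup cs′ i
  ≈ᵢ = Pointwise.lookup cs≈cs′
  cong₃ : ∀ {A B C D : Set} (f : A → B → C → D) {x x′ y y′ z z′} →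
          x ≡ x′ → y ≡ y′ → z ≡ z′ → f x y z ≡ f x′ y′ z′
  cong₃ f refl refl refl = refl

≈-node-intro : ∀ {k} (d : Deco k) (cs : Vec Tree k) → DisjointChildren cs → ∀ t →
               (∀ {x} → x ∈ leavesV cs → x ∈ leaves t) →
               (∀ {x} → x ∈ leaves t → x ∈ leavesV cs) →
               (∀ i {a b} → a ∈ leaves (lookup cs i) → b ∈ leaves (lookup cs i) →
                  treeAdj t a b ≡ treeAdj (lookup cs i) a b) →
               (∀ {i j a b} → a ∈ leaves (lookup cs i) → b ∈ leaves (lookup cs j) → i ≢ j →
                  treeAdj t a b ≡ adj (decoGraph d) i j) →
               node d cs ≈ t
≈-node-intro d cs D t ⊆t ⊇t same diff = record { leaves⊆ = ⊆t ; leaves⊇ = ⊇t ; treeAdj≡ = adj≡ }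
  where
  adj≡ : ∀ a b → treeAdj (node d cs) a b ≡ treeAdj t a b
  adj≡ a b with a ∈? leavesV cs | b ∈? leavesV cs
  ... | no a∉ | _ = trans (treeAdj-∉ˡ (node d cs) b a∉) (sym (treeAdj-∉ˡ t b (a∉ ∘ ⊇t)))
  ... | yes _ | no b∉ = trans (treeAdj-∉ʳ (node d cs) a b∉) (sym (treeAdj-∉ʳ t a (b∉ ∘ ⊇t)))
  ... | yes a∈ | yes b∈ with ∈-leavesV⁻ cs a∈ | ∈-leavesV⁻ cs b∈
  ...   | i , a∈i | j , b∈j with i Fin.≟ j
  ...     | yes refl = trans (treeAdj-node-same d cs D i a∈i b∈j) (sym (same i a∈i b∈j))
  ...     | no i≢j = trans (treeAdj-node-diff d cs D a∈i b∈j i≢j) (sym (diff a∈i b∈j i≢j))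

≈ᵥ-update : ∀ {k} (cs : Vec Tree k) i {c} → lookup cs i ≈ c → cs ≈ᵥ (cs [ i ]≔ c)
≈ᵥ-update (c ∷ cs) zero c≈ = c≈ ∷ Pointwise.refl ≈-refl
≈ᵥ-update (c ∷ cs) (suc i) c≈ = ≈-refl ∷ ≈ᵥ-update cs i c≈

minList-∈ : ∀ (xs : List ℕ) {x} → x ∈ xs → minList xs ∈ xs
minList-∈ (y ∷ ys) _ = go y ys
  where
  go : ∀ y ys → foldr _⊓_ y ys ∈ y ∷ ys
  go y [] = here refl
  go y (z ∷ zs) with ℕ.⊓-sel z (foldr _⊓_ y zs)
  ... | inj₁ e rewrite e = there (here refl)
  ... | inj₂ e rewrite e with go y zs
  ...   | here q = here q
  ...   | there q = there (there q)

minList-≤ : ∀ (xs : List ℕ) {y} → y ∈ xs → minList xs ≤ y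
minList-≤ (x ∷ xs) = go x xs
  where
  go : ∀ x xs {y} → y ∈ x ∷ xs → foldr _⊓_ x xs ≤ y
  go x [] (here refl) = ℕ.≤-refl
  go x (z ∷ zs) (here refl) = ℕ.≤-trans (ℕ.m⊓n≤n z _) (go x zs (here refl))
  go x (z ∷ zs) (there (here refl)) = ℕ.m⊓n≤m z _
  go x (z ∷ zs) (there (there p)) = ℕ.≤-trans (ℕ.m⊓n≤n z _) (go x zs (there p))

minList-unique : ∀ (xs : List ℕ) {v} → v ∈ xs → (∀ {y} → y ∈ xs → v ≤ y) → minList xs ≡ v
minList-unique xs v∈xs v≤xs = ℕ.≤-antisym (minList-≤ xs v∈xs) (v≤xs (minList-∈ xs v∈xs))

minLeaf-cong : ∀ {t u x} → t ≈ u → x ∈ leaves t → minLeaf t ≡ minLeaf u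
minLeaf-cong {t} {u} t≈u x∈t =
  sym (minList-unique (leaves u) (leaves⊆ t≈u (minList-∈ (leaves t) x∈t))
        (minList-≤ (leaves t) ∘ leaves⊇ t≈u))

WellLabelled : Tree → Set
WellLabelled t = WF t × Unique (leaves t)

WF⇒nonempty : ∀ {t} → WF t → ∃ λ x → x ∈ leaves t
WF⇒nonempty (wf-leaf a) = a , here refl
WF⇒nonempty (wf-node d (c ∷ cs) _ _ (wf ∷ _)) = let x , p = WF⇒nonempty wf in x , ∈-++⁺ˡ p

WF-sorted : ∀ {k} {d : Deco k} {cs} → WF (node d cs) → SortedChildren cs
WF-sorted (wf-node _ _ _ sorted _) = sorted

SortedChildren-≤ : ∀ {k} (cs : Vec Tree k) → SortedChildren cs → ∀ {i j} → i Fin.≤ j →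
                   minLeaf (lookup cs i) ≤ minLeaf (lookup cs j)
SortedChildren-≤ cs sorted {i} {j} i≤j with i Fin.≟ j
... | yes refl = ℕ.≤-refl
... | no i≢j = ℕ.<⇒≤ (sorted i j (Fin.≤∧≢⇒< i≤j i≢j))

WellLabelled-child : ∀ {k} {d : Deco k} {cs : Vec Tree k} → WellLabelled (node d cs) →
                     ∀ i → WellLabelled (lookup cs i)
WellLabelled-child {cs = cs} (wf-node _ _ _ _ wfs , u) i =
  Allₚ.lookup⁺ wfs i , proj₁ (Unique-leavesV⁻ cs u) i

WellLabelled-node-cong : ∀ {k} (d : Deco k) {cs cs′ : Vec Tree k} → WellLabelled (node d cs) →
                         cs ≈ᵥ cs′ → All WellLabelled cs′ → WellLabelled (node d cs′)
WellLabelled-node-cong d {cs} {cs′} (wf-node _ _ k≥2 sorted wfs , u) cs≈cs′ wls =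
  wf-node d cs′ k≥2 sorted′ (All.map proj₁ wls) ,
  Unique-leavesV⁺ cs′ (proj₂ ∘ Allₚ.lookup⁺ wls)
    (λ i j p q → proj₂ (Unique-leavesV⁻ cs u) i j (leaves⊇ (≈ᵢ i) p) (leaves⊇ (≈ᵢ j) q))
  where
  ≈ᵢ : ∀ i → lookup cs i ≈ lookup cs′ i
  ≈ᵢ = Pointwise.lookup cs≈cs′
  minLeaf≡ : ∀ i → minLeaf (lookup cs i) ≡ minLeaf (lookup cs′ i)
  minLeaf≡ i = minLeaf-cong (≈ᵢ i) (proj₂ (WF⇒nonempty (Allₚ.lookup⁺ wfs i)))
  sorted′ : SortedChildren cs′
  sorted′ i j i<j = subst₂ _<_ (minLeaf≡ i) (minLeaf≡ j) (sorted i j i<j)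

WellLabelled-redecorate : ∀ {k} {d : Deco k} (d′ : Deco k) {cs} → WellLabelled (node d cs) →
                          WellLabelled (node d′ cs)
WellLabelled-redecorate d′ (wf-node _ cs k≥2 sorted wfs , u) = wf-node d′ cs k≥2 sorted wfs , u

SubstTreeOf-intro : ∀ {n} (G : LGraph n) {t} → WellLabelled t →
                    (∀ {x} → x ∈ leaves t → x ∈ upTo n) →
                    (∀ {x} → x ∈ upTo n → x ∈ leaves t) →
                    (∀ i j → treeAdj t (toℕ i) (toℕ j) ≡ adj G i j) → SubstTreeOf t G
SubstTreeOf-intro {n} G (wf , u) ⊆upTo ⊇upTo adj≡ =
  wf , ∼bag⇒↭ (unique∧set⇒bag u (Unique.upTo⁺ n) (mk⇔ ⊆upTo ⊇upTo)) , adj≡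

SubstTreeOf⇒WellLabelled : ∀ {t n} {G : LGraph n} → SubstTreeOf t G → WellLabelled t
SubstTreeOf⇒WellLabelled {n = n} (wf , perm , _) =
  wf , Perm.Unique-resp-↭ (↭⇒↭ₛ (↭-sym perm)) (Unique.upTo⁺ n)

SubstTreeOf-resp-≈ : ∀ {t u n} {G : LGraph n} → SubstTreeOf t G → t ≈ u → WellLabelled u →
                     SubstTreeOf u G
SubstTreeOf-resp-≈ {G = G} (_ , perm , adj≡) t≈u wl =
  SubstTreeOf-intro G wl (∈-resp-↭ perm ∘ leaves⊇ t≈u) (leaves⊆ t≈u ∘ ∈-resp-↭ (↭-sym perm))
    (λ i j → trans (sym (treeAdj≡ t≈u (toℕ i) (toℕ j))) (adj≡ i j))

leafVec : ∀ k → Vec Tree k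
leafVec k = tabulate (leaf ∘ toℕ)

lookup-leafVec : ∀ {k} (i : Fin k) → lookup (leafVec k) i ≡ leaf (toℕ i)
lookup-leafVec = Vec.lookup∘tabulate (leaf ∘ toℕ)

∈-leafVec⁻ : ∀ {k} {i : Fin k} {x} → x ∈ leaves (lookup (leafVec k) i) → x ≡ toℕ i
∈-leafVec⁻ {i = i} p with here e ← ∈-leaves-≡ (lookup-leafVec i) p = e

∈-leafVec⁺ : ∀ {k} (i : Fin k) → toℕ i ∈ leaves (lookup (leafVec k) i)
∈-leafVec⁺ i = ∈-leaves-≡ (sym (lookup-leafVec i)) (here refl)

DisjointChildren-leafVec : ∀ k → DisjointChildren (leafVec k)
DisjointChildren-leafVec k i j p q = Fin.toℕ-injective (trans (sym (∈-leafVec⁻ p)) (∈-leafVec⁻ q))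

WellLabelled-leafVec : ∀ {k} (d : Deco k) → 2 ≤ k → WellLabelled (node d (leafVec k))
WellLabelled-leafVec {k} d k≥2 =
  wf-node d (leafVec k) k≥2 sorted (Allₚ.lookup⁻ λ i → subst WF (sym (lookup-leafVec i)) (wf-leaf _)) ,
  Unique-leavesV⁺ (leafVec k) (λ i → subst (Unique ∘ leaves) (sym (lookup-leafVec i)) (List.[] ∷ []))
    (DisjointChildren-leafVec k)
  where
  sorted : SortedChildren (leafVec k)
  sorted i j i<j rewrite lookup-leafVec i | lookup-leafVec j = i<j

AgreeOffDiagonal : ∀ {k} → LGraph k → LGraph k → Set
AgreeOffDiagonal {k} H H′ = ∀ i j → i ≢ j → adj H i j ≡ adj H′ i j

leafVec-SubstTreeOf : ∀ {k} (d : Deco k) (H : LGraph k) → 2 ≤ k →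
                      AgreeOffDiagonal (decoGraph d) H → SubstTreeOf (node d (leafVec k)) H
leafVec-SubstTreeOf {k} d H k≥2 agree = SubstTreeOf-intro H (WellLabelled-leafVec d k≥2) ⊆upTo ⊇upTo adj≡
  where
  ⊆upTo : ∀ {x} → x ∈ leavesV (leafVec k) → x ∈ upTo k
  ⊆upTo p with i , q ← ∈-leavesV⁻ (leafVec k) p =
    subst (_∈ upTo k) (sym (∈-leafVec⁻ q)) (∈-upTo⁺ (Fin.toℕ<n i))
  ⊇upTo : ∀ {x} → x ∈ upTo k → x ∈ leavesV (leafVec k)
  ⊇upTo p = subst (_∈ leavesV (leafVec k)) (Fin.toℕ-fromℕ< (∈-upTo⁻ p))
              (∈-leavesV⁺ (leafVec k) _ (∈-leafVec⁺ (Fin.fromℕ< (∈-upTo⁻ p))))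
  adj≡ : ∀ i j → treeAdj (node d (leafVec k)) (toℕ i) (toℕ j) ≡ adj H i j
  adj≡ i j with i Fin.≟ j
  ... | yes refl = begin
    treeAdj (node d (leafVec k)) (toℕ i) (toℕ i)
      ≡⟨ treeAdj-node-same d (leafVec k) (DisjointChildren-leafVec k) i (∈-leafVec⁺ i) (∈-leafVec⁺ i) ⟩
    treeAdj (lookup (leafVec k) i) (toℕ i) (toℕ i)
      ≡⟨ cong (λ t → treeAdj t (toℕ i) (toℕ i)) (lookup-leafVec i) ⟩
    false
      ≡⟨ adj-irrefl H i ⟨
    adj H i i ∎
    where open ≡-Reasoning
  ... | no i≢j =
    trans (treeAdj-node-diff d (leafVec k) (DisjointChildren-leafVec k) (∈-leafVec⁺ i) (∈-leafVec⁺ j) i≢j)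
          (agree i j i≢j)

data ChildInflation : ∀ {k} → Vec Tree k → Vec Tree k → Set where
  child : ∀ {k} (cs : Vec Tree k) i {c′} → Inflation (lookup cs i) c′ → ChildInflation cs (cs [ i ]≔ c′)

ChildInflations : ∀ {k} → Vec Tree k → Vec Tree k → Set
ChildInflations = Star ChildInflation

Inflations-node : ∀ {k} (d : Deco k) {cs cs′ : Vec Tree k} →
                  ChildInflations cs cs′ → Inflations (node d cs) (node d cs′)
Inflations-node d = Star.gmap (node d) λ { (child cs i {c′} step) → under d cs i c′ step }

ChildInflations-head : ∀ {k c c′} (cs : Vec Tree k) → Inflations c c′ →
                       ChildInflations (c ∷ cs) (c′ ∷ cs)
ChildInflations-head cs = Star.gmap (_∷ cs) (child (_ ∷ cs) zero)

ChildInflations-tail : ∀ {k} c {cs cs′ : Vec Tree k} → ChildInflations cs cs′ →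
                       ChildInflations (c ∷ cs) (c ∷ cs′)
ChildInflations-tail c = Star.gmap (c ∷_) λ { (child cs i step) → child (c ∷ cs) (suc i) step }

Inflations-update : ∀ {k} (d : Deco k) (cs : Vec Tree k) i {c c′} →
                    Inflations c c′ → Inflations (node d (cs [ i ]≔ c)) (node d (cs [ i ]≔ c′))
Inflations-update d cs i ε = ε
Inflations-update d cs i {c} (_◅_ {j = c₁} step steps) =
  subst (Inflation (node d (cs [ i ]≔ c)) ∘ node d) (Vec.[]≔-idempotent cs i)
    (under d (cs [ i ]≔ c) i c₁ (subst (λ c → Inflation c c₁) (sym (Vec.lookup∘update i cs c)) step))
  ◅ Inflations-update d cs i steps

Inflations-at : ∀ {k} (d : Deco k) (cs : Vec Tree k) i {c′} →
                Inflations (lookup cs i) c′ → Inflations (node d cs) (node d (cs [ i ]≔ c′))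
Inflations-at d cs i steps =
  subst (λ cs₀ → Inflations (node d cs₀) (node d (cs [ i ]≔ _))) (Vec.[]≔-lookup cs i)
    (Inflations-update d cs i steps)

All-update⁺ : ∀ {P : Tree → Set} {k} (cs : Vec Tree k) i {c} →
              (∀ j → j ≢ i → P (lookup cs j)) → P c → All P (cs [ i ]≔ c)
All-update⁺ {P} cs i {c} others Pc = Allₚ.lookup⁻ P-updated
  where
  P-updated : ∀ j → P (lookup (cs [ i ]≔ c) j)
  P-updated j with j Fin.≟ i
  ... | yes refl = subst P (sym (Vec.lookup∘update j cs c)) Pc
  ... | no j≢i = subst P (sym (Vec.lookup∘update′ j≢i cs c)) (others j j≢i)

lookupD-toℕ : ∀ {A : Set} {k} (xs : Vec A k) i d → lookupD xs (toℕ i) d ≡ lookup xs i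
lookupD-toℕ (x ∷ xs) zero d = refl
lookupD-toℕ (x ∷ xs) (suc i) d = lookupD-toℕ xs i d

graft-leaf : ∀ {k} (cs : Vec Tree k) i → graft (leaf (toℕ i)) cs ≡ lookup cs i
graft-leaf cs i = lookupD-toℕ cs i _

graftV-tabulate : ∀ {m k} (f : Fin m → Tree) (cs : Vec Tree k) →
                  graftV (tabulate f) cs ≡ tabulate (λ p → graft (f p) cs)
graftV-tabulate {zero} f cs = refl
graftV-tabulate {suc m} f cs = cong (graft (f zero) cs ∷_) (graftV-tabulate (f ∘ suc) cs)

graftV-leafVec : ∀ {k} (cs : Vec Tree k) → graftV (leafVec k) cs ≡ cs
graftV-leafVec {k} cs = begin
  graftV (leafVec k) cs                     ≡⟨ graftV-tabulate (leaf ∘ toℕ) cs ⟩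
  tabulate (λ i → graft (leaf (toℕ i)) cs) ≡⟨ Vec.tabulate-cong (graft-leaf cs) ⟩
  tabulate (lookup cs)                      ≡⟨ Vec.tabulate∘lookup cs ⟩
  cs                                        ∎
  where open ≡-Reasoning

redecorate-≈ : ∀ {k} (d d′ : Deco k) (cs : Vec Tree k) → AgreeOffDiagonal (decoGraph d) (decoGraph d′) →
               node d cs ≈ node d′ cs
redecorate-≈ d d′ cs agree = record
  { leaves⊆ = λ p → p ; leaves⊇ = λ p → p
  ; treeAdj≡ = λ a b → combine-agree (locate cs a) (locate cs b) (innerAdj cs a b) }
  where
  combine-agree : ∀ x y inner → combine (decoGraph d) x y inner ≡ combine (decoGraph d′) x y inner
  combine-agree (just i) (just j) inner with i Fin.≟ j
  ... | yes _ = refl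
  ... | no i≢j = agree i j i≢j
  combine-agree (just _) nothing _ = refl
  combine-agree nothing _ _ = refl

redecorate-Inflation : ∀ {k} (d d′ : Deco k) (cs : Vec Tree k) → 2 ≤ k →
                       AgreeOffDiagonal (decoGraph d) (decoGraph d′) → Inflation (node d cs) (node d′ cs)
redecorate-Inflation {k} d d′ cs k≥2 agree =
  subst (Inflation (node d cs) ∘ node d′) (graftV-leafVec cs)
    (here d cs (node d′ (leafVec k)) (leafVec-SubstTreeOf d′ (decoGraph d) k≥2 (λ i j → sym ∘ agree i j)))

record Expansion (t : Tree) : Set where
  field
    tree : Tree
    inflations : Inflations t tree
    expanded : ExpandedShape tree
    wellLabelled : WellLabelled tree
    ≈tree : t ≈ tree

Expansion-refl : ∀ {t} → ExpandedShape t → WellLabelled t → Expansion t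
Expansion-refl ex wl = record { inflations = ε ; expanded = ex ; wellLabelled = wl ; ≈tree = ≈-refl }

Expansion-prepend : ∀ {t u} → Inflations t u → t ≈ u → Expansion u → Expansion t
Expansion-prepend steps t≈u e = record
  { inflations = steps ◅◅ inflations ; expanded = expanded ; wellLabelled = wellLabelled
  ; ≈tree = ≈-trans t≈u ≈tree }
  where open Expansion e

Expansion-redecorate : ∀ {k} (d d′ : Deco k) (cs : Vec Tree k) → 2 ≤ k →
                       AgreeOffDiagonal (decoGraph d) (decoGraph d′) → WellLabelled (node d cs) →
                       ExpandedShape (node d′ cs) → Expansion (node d cs)
Expansion-redecorate d d′ cs k≥2 agree wl ex =
  Expansion-prepend (redecorate-Inflation d d′ cs k≥2 agree ◅ ε) (redecorate-≈ d d′ cs agree)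
    (Expansion-refl ex (WellLabelled-redecorate d′ wl))

AgreeOffDiagonal-2 : (H H′ : LGraph 2) → adj H zero (suc zero) ≡ adj H′ zero (suc zero) →
                     AgreeOffDiagonal H H′
AgreeOffDiagonal-2 H H′ e zero zero 0≢0 = ⊥-elim (0≢0 refl)
AgreeOffDiagonal-2 H H′ e zero (suc zero) _ = e
AgreeOffDiagonal-2 H H′ e (suc zero) zero _ = trans (adj-sym H _ _) (trans e (adj-sym H′ _ _))
AgreeOffDiagonal-2 H H′ e (suc zero) (suc zero) 1≢1 = ⊥-elim (1≢1 refl)

Expansion-binary : (d : Deco 2) (cs : Vec Tree 2) → WellLabelled (node d cs) → All ExpandedShape cs →
                   Expansion (node d cs)
Expansion-binary ⊕ cs wl exs = Expansion-refl (ex-plus cs exs) wl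
Expansion-binary ⊖ cs wl exs = Expansion-refl (ex-minus cs exs) wl
Expansion-binary (gr H) cs wl exs with adj H zero (suc zero) in e
... | true =
  Expansion-redecorate (gr H) ⊕ cs ℕ.≤-refl (AgreeOffDiagonal-2 H (complete 2) e) wl (ex-plus cs exs)
... | false =
  Expansion-redecorate (gr H) ⊖ cs ℕ.≤-refl (AgreeOffDiagonal-2 H (edgeless 2) e) wl (ex-minus cs exs)

-- Modules

record Enumeration {k} (S : Fin k → Set) : Set where
  field
    size : ℕ
    at : Fin size → Fin k
    at-mono : ∀ {p q} → p Fin.< q → at p Fin.< at q
    at-∈ : ∀ p → S (at p)
    at-onto : ∀ w → S w → ∃ λ p → at p ≡ w

  at-injective : ∀ {p q} → at p ≡ at q → p ≡ q
  at-injective {p} {q} e with Fin.<-cmp p q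
  ... | tri< p<q _ _ = ⊥-elim (Fin.<-irrefl e (at-mono p<q))
  ... | tri≈ _ p≡q _ = p≡q
  ... | tri> _ _ q<p = ⊥-elim (Fin.<-irrefl (sym e) (at-mono q<p))

  at-mono-≤ : ∀ {p q} → p Fin.≤ q → at p Fin.≤ at q
  at-mono-≤ {p} {q} p≤q with p Fin.≟ q
  ... | yes refl = Fin.≤-refl
  ... | no p≢q = ℕ.<⇒≤ (at-mono (Fin.≤∧≢⇒< p≤q p≢q))

  index : ∀ w → S w → Fin size
  index w Sw = proj₁ (at-onto w Sw)

  at-index : ∀ w Sw → at (index w Sw) ≡ w
  at-index w Sw = proj₂ (at-onto w Sw)

enumerate : ∀ {k} (S : Fin k → Set) → (∀ w → Dec (S w)) → Enumeration S
enumerate {zero} S S? = record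
  { size = 0 ; at = λ () ; at-mono = λ {p} → ⊥-elim (Fin.¬Fin0 p) ; at-∈ = λ () ; at-onto = λ () }
enumerate {suc k} S S? with enumerate (S ∘ suc) (S? ∘ suc) | S? zero
... | E | yes S0 = record { size = suc size ; at = at′ ; at-mono = mono′ ; at-∈ = ∈′ ; at-onto = onto′ }
  where
  open Enumeration E
  at′ : Fin (suc size) → Fin (suc k)
  at′ zero = zero
  at′ (suc p) = suc (at p)
  mono′ : ∀ {p q} → p Fin.< q → at′ p Fin.< at′ q
  mono′ {zero} {suc q} _ = s≤s z≤n
  mono′ {suc p} {suc q} (s≤s p<q) = s≤s (at-mono p<q)
  ∈′ : ∀ p → S (at′ p)
  ∈′ zero = S0
  ∈′ (suc p) = at-∈ p
  onto′ : ∀ w → S w → ∃ λ p → at′ p ≡ w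
  onto′ zero _ = zero , refl
  onto′ (suc w) Sw = let p , e = at-onto w Sw in suc p , cong suc e
... | E | no ¬S0 =
  record { size = size ; at = suc ∘ at ; at-mono = s≤s ∘ at-mono ; at-∈ = at-∈ ; at-onto = onto′ }
  where
  open Enumeration E
  onto′ : ∀ w → S w → ∃ λ p → suc (at p) ≡ w
  onto′ zero S0 = ⊥-elim (¬S0 S0)
  onto′ (suc w) Sw = let p , e = at-onto w Sw in p , cong suc e

injective-missing⇒< : ∀ {m k} (f : Fin m → Fin k) → (∀ {p q} → f p ≡ f q → p ≡ q) →
                      ∀ v → (∀ p → f p ≢ v) → m < k
injective-missing⇒< {k = suc k} f f-inj v f≢v =
  s≤s (Fin.injective⇒≤ {f = f′} λ e →
    f-inj (Fin.punchOut-injective (f≢v _ ∘ sym) (f≢v _ ∘ sym) e))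
  where
  f′ : Fin _ → Fin k
  f′ p = Fin.punchOut (f≢v p ∘ sym)

distinct⇒2≤ : ∀ {m} {p q : Fin m} → p ≢ q → 2 ≤ m
distinct⇒2≤ {suc zero} {zero} {zero} 0≢0 = ⊥-elim (0≢0 refl)
distinct⇒2≤ {suc (suc m)} _ = s≤s (s≤s z≤n)

NonTrivial : ∀ {k} → (Fin k → Bool) → Set
NonTrivial {k} M =
  (∃ λ u → ∃ λ v → u ≢ v × M u ≡ true × M v ≡ true) × (∃ λ x → M x ≡ false)

NonTrivialModule : ∀ {k} → LGraph k → (Fin k → Bool) → Set
NonTrivialModule H M = IsModule H M × NonTrivial M

NonTrivialModule-resp-≗ : ∀ {k} (H : LGraph k) {M M′ : Fin k → Bool} → (∀ i → M i ≡ M′ i) →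
                          NonTrivialModule H M → NonTrivialModule H M′
NonTrivialModule-resp-≗ H {M} {M′} M≗M′ (mod , (u , v , u≢v , Mu , Mv) , x , Mx) =
  (λ x Mx y z My Mz → mod x (≗⁻ Mx) y z (≗⁻ My) (≗⁻ Mz)) ,
  (u , v , u≢v , ≗⁺ Mu , ≗⁺ Mv) , x , ≗⁺ Mx
  where
  ≗⁺ : ∀ {i b} → M i ≡ b → M′ i ≡ b
  ≗⁺ {i} = trans (sym (M≗M′ i))
  ≗⁻ : ∀ {i b} → M′ i ≡ b → M i ≡ b
  ≗⁻ {i} = trans (M≗M′ i)

nonTrivialModule? : ∀ {k} (H : LGraph k) → Dec (∃ (NonTrivialModule H))
nonTrivialModule? {k} H =
  map′ (λ (s , ntm) → lookup s , ntm)
       (λ (M , ntm) → tabulate M , NonTrivialModule-resp-≗ H (sym ∘ Vec.lookup∘tabulate M) ntm)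
    (anySubset? λ s → module? (lookup s) ×-dec nonTrivial? (lookup s))
  where
  module? : ∀ M → Dec (IsModule H M)
  module? M = Fin.all? λ x → (M x ≟ᵇ false) →-dec Fin.all? λ y → Fin.all? λ z →
                (M y ≟ᵇ true) →-dec (M z ≟ᵇ true) →-dec (adj H x y ≟ᵇ adj H x z)
  nonTrivial? : ∀ M → Dec (NonTrivial M)
  nonTrivial? M =
    (Fin.any? λ u → Fin.any? λ v → ¬? (u Fin.≟ v) ×-dec (M u ≟ᵇ true) ×-dec (M v ≟ᵇ true))
    ×-dec Fin.any? λ x → M x ≟ᵇ false

every-set-module-edgeless : ∀ {k} (M : Fin k → Bool) → IsModule (edgeless k) M
every-set-module-edgeless M _ _ _ _ _ _ = refl

every-set-module-complete : ∀ {k} (M : Fin k → Bool) → IsModule (complete k) M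
every-set-module-complete M x Mx y z My Mz with x Fin.≟ y | x Fin.≟ z
... | yes refl | _ with () ← trans (sym My) Mx
... | _ | yes refl with () ← trans (sym Mz) Mx
... | no _ | no _ = refl

firstTwo : ∀ {k} → Fin k → Bool
firstTwo i = toℕ i ℕ.<ᵇ 2

NonTrivial-firstTwo : ∀ {k} → NonTrivial (firstTwo {3 ℕ.+ k})
NonTrivial-firstTwo = (zero , suc zero , (λ ()) , refl , refl) , suc (suc zero) , refl

¬NonTrivialModule⇒Prime : ∀ {k} (H : LGraph k) → 3 ≤ k → ¬ ∃ (NonTrivialModule H) → Prime H
¬NonTrivialModule⇒Prime {k} H k≥3 ¬ntm = k≥3 , trivial
  where
  trivial : ∀ M → IsModule H M → TrivialSet M
  trivial M mod with Fin.any? (λ v → M v ≟ᵇ true)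
  ... | no ¬v = inj₁ λ x → ¬-not (¬v ∘ (x ,_))
  ... | yes (v , Mv) with Fin.any? (λ u → ¬? (u Fin.≟ v) ×-dec (M u ≟ᵇ true))
  ...   | no ¬u = inj₂ (inj₁ (v , Mv , singleton))
    where
    singleton : ∀ y → M y ≡ true → y ≡ v
    singleton y My with y Fin.≟ v
    ... | yes y≡v = y≡v
    ... | no y≢v = ⊥-elim (¬u (y , y≢v , My))
  ...   | yes (u , u≢v , Mu) with Fin.any? (λ x → M x ≟ᵇ false)
  ...     | no ¬x = inj₂ (inj₂ λ x → ¬-not (¬x ∘ (x ,_)))
  ...     | yes (x , Mx) = ⊥-elim (¬ntm (M , mod , (u , v , u≢v , Mu , Mv) , x , Mx))

-- Splitting a node along a non-trivial module

restrict : ∀ {k m} → LGraph k → (Fin m → Fin k) → LGraph m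
restrict H f = record
  { adj = λ p q → adj H (f p) (f q)
  ; adj-sym = λ p q → adj-sym H (f p) (f q)
  ; adj-irrefl = λ p → adj-irrefl H (f p) }

module Split {k} (d : Deco k) (M : Fin k → Bool) (mod : IsModule (decoGraph d) M)
             {u v : Fin k} (u≢v : u ≢ v) (Mu : M u ≡ true) (Mv : M v ≡ true)
             {x : Fin k} (Mx : M x ≡ false) where

  H : LGraph k
  H = decoGraph d

  M-conflict : ∀ {w} → M w ≡ true → M w ≡ false → ⊥
  M-conflict Mw Mw′ with () ← trans (sym Mw) Mw′

  members : Enumeration (λ w → M w ≡ true)
  members = enumerate _ (λ w → M w ≟ᵇ true)
  module Mem = Enumeration members

  2≤#M : 2 ≤ Mem.size
  2≤#M = distinct⇒2≤ λ e →
    u≢v (trans (sym (Mem.at-index u Mu)) (trans (cong Mem.at e) (Mem.at-index v Mv)))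

  #M<k : Mem.size < k
  #M<k = injective-missing⇒< Mem.at Mem.at-injective x λ p e →
    M-conflict (Mem.at-∈ p) (subst (λ w → M w ≡ false) (sym e) Mx)

  0<#M : 0 < Mem.size
  0<#M = ℕ.≤-trans (s≤s z≤n) 2≤#M

  first : Fin Mem.size
  first = Fin.fromℕ< 0<#M

  first-least : ∀ (p : Fin Mem.size) → first Fin.≤ p
  first-least p = subst (ℕ._≤ toℕ p) (sym (Fin.toℕ-fromℕ< 0<#M)) z≤n

  -- M is collapsed onto its least member, so that the factor node takes that member's place
  -- in the sorted order of the children.
  m₀ : Fin k
  m₀ = Mem.at first

  Mm₀ : M m₀ ≡ true
  Mm₀ = Mem.at-∈ first

  m₀-least : ∀ w → M w ≡ true → m₀ Fin.≤ w
  m₀-least w Mw = subst (m₀ Fin.≤_) (Mem.at-index w Mw) (Mem.at-mono-≤ (first-least _))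

  Rep : Fin k → Set
  Rep w = M w ≡ false ⊎ w ≡ m₀

  reps : Enumeration Rep
  reps = enumerate Rep (λ w → (M w ≟ᵇ false) ⊎-dec (w Fin.≟ m₀))
  module Rep = Enumeration reps

  p₀ : Fin Rep.size
  p₀ = Rep.index m₀ (inj₂ refl)

  at-p₀ : Rep.at p₀ ≡ m₀
  at-p₀ = Rep.at-index m₀ (inj₂ refl)

  outsider : ∀ w → M w ≡ false → Fin Rep.size
  outsider w Mw = Rep.index w (inj₁ Mw)

  at-outsider : ∀ w Mw → Rep.at (outsider w Mw) ≡ w
  at-outsider w Mw = Rep.at-index w (inj₁ Mw)

  outsider≢m₀ : ∀ {w} → M w ≡ false → w ≢ m₀
  outsider≢m₀ Mw refl = M-conflict Mm₀ Mw

  outsider≢p₀ : ∀ {w} Mw → outsider w Mw ≢ p₀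
  outsider≢p₀ {w} Mw e = outsider≢m₀ Mw (trans (sym (at-outsider w Mw)) (trans (cong Rep.at e) at-p₀))

  2≤#R : 2 ≤ Rep.size
  2≤#R = distinct⇒2≤ (outsider≢p₀ Mx)

  Rep-misses : ∀ {w} → M w ≡ true → w ≢ m₀ → ∀ p → Rep.at p ≢ w
  Rep-misses Mw w≢m₀ p refl with Rep.at-∈ p
  ... | inj₁ Mw′ = M-conflict Mw Mw′
  ... | inj₂ w≡m₀ = w≢m₀ w≡m₀

  #R<k : Rep.size < k
  #R<k with u Fin.≟ m₀
  ... | yes u≡m₀ =
    injective-missing⇒< Rep.at Rep.at-injective v (Rep-misses Mv (u≢v ∘ trans u≡m₀ ∘ sym))
  ... | no u≢m₀ = injective-missing⇒< Rep.at Rep.at-injective u (Rep-misses Mu u≢m₀)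

  quotient : LGraph Rep.size
  quotient = restrict H Rep.at

  factor : LGraph Mem.size
  factor = restrict H Mem.at

  factorNode : (Fin k → Tree) → Tree
  factorNode g = node (gr factor) (tabulate (g ∘ Mem.at))

  block : (Fin k → Tree) → Fin Rep.size → Tree
  block g p = if ⌊ Rep.at p Fin.≟ m₀ ⌋ then factorNode g else g (Rep.at p)

  -- the tree quotient[…, factor[G w | w ∈ M], …] replacing H[G₁, …, G_k]
  split : (Fin k → Tree) → Tree
  split g = node (gr quotient) (tabulate (block g))

  block-p₀ : ∀ g {p} → Rep.at p ≡ m₀ → block g p ≡ factorNode g
  block-p₀ g {p} e with Rep.at p Fin.≟ m₀
  ... | yes _ = refl
  ... | no ne = ⊥-elim (ne e)

  block-other : ∀ g {p} → Rep.at p ≢ m₀ → block g p ≡ g (Rep.at p)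
  block-other g {p} ne with Rep.at p Fin.≟ m₀
  ... | yes e = ⊥-elim (ne e)
  ... | no _ = refl

  split-cong : ∀ {g g′} → (∀ w → g w ≡ g′ w) → split g ≡ split g′
  split-cong {g} {g′} g≗g′ = cong (node (gr quotient)) (Vec.tabulate-cong block≗)
    where
    block≗ : ∀ p → block g p ≡ block g′ p
    block≗ p with Rep.at p Fin.≟ m₀
    ... | yes _ = cong (node (gr factor)) (Vec.tabulate-cong (g≗g′ ∘ Mem.at))
    ... | no _ = g≗g′ (Rep.at p)

  τ : Tree
  τ = split (leaf ∘ toℕ)

  graft-τ : ∀ (cs : Vec Tree k) → graft τ cs ≡ split (lookup cs)
  graft-τ cs = cong (node (gr quotient))
    (trans (graftV-tabulate (block (leaf ∘ toℕ)) cs) (Vec.tabulate-cong graft-block))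
    where
    graft-block : ∀ p → graft (block (leaf ∘ toℕ) p) cs ≡ block (lookup cs) p
    graft-block p with Rep.at p Fin.≟ m₀
    ... | yes _ = cong (node (gr factor))
      (trans (graftV-tabulate (leaf ∘ toℕ ∘ Mem.at) cs) (Vec.tabulate-cong (graft-leaf cs ∘ Mem.at)))
    ... | no _ = graft-leaf cs (Rep.at p)

  module OnChildren (cs : Vec Tree k) (wl : WellLabelled (node d cs)) where

    G : Fin k → Tree
    G = lookup cs

    D : DisjointChildren cs
    D = proj₂ (Unique-leavesV⁻ cs (proj₂ wl))

    children : Vec Tree Rep.size
    children = tabulate (block G)

    factorChildren : Vec Tree Mem.size
    factorChildren = tabulate (G ∘ Mem.at)

    lookup-factorChildren : ∀ q → lookup factorChildren q ≡ G (Mem.at q)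
    lookup-factorChildren = Vec.lookup∘tabulate (G ∘ Mem.at)

    lookup-p₀ : lookup children p₀ ≡ factorNode G
    lookup-p₀ = trans (Vec.lookup∘tabulate (block G) p₀) (block-p₀ G at-p₀)

    lookup-other : ∀ {p} → p ≢ p₀ → lookup children p ≡ G (Rep.at p)
    lookup-other {p} p≢p₀ =
      trans (Vec.lookup∘tabulate (block G) p)
            (block-other G (p≢p₀ ∘ Rep.at-injective ∘ flip trans (sym at-p₀)))

    lookup-outsider : ∀ w Mw → lookup children (outsider w Mw) ≡ G w
    lookup-outsider w Mw = trans (lookup-other (outsider≢p₀ Mw)) (cong G (at-outsider w Mw))

    ∈-factorChild : ∀ q {x} → x ∈ leaves (G (Mem.at q)) → x ∈ leaves (lookup factorChildren q)
    ∈-factorChild q = ∈-leaves-≡ (sym (lookup-factorChildren q))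

    ∈-p₀ : ∀ {w x} → M w ≡ true → x ∈ leaves (G w) → x ∈ leaves (lookup children p₀)
    ∈-p₀ {w} Mw p with q , refl ← Mem.at-onto w Mw =
      ∈-leaves-≡ (sym lookup-p₀) (∈-leavesV⁺ factorChildren q (∈-factorChild q p))

    ∈-outsider : ∀ {w x} Mw → x ∈ leaves (G w) → x ∈ leaves (lookup children (outsider w Mw))
    ∈-outsider {w} Mw = ∈-leaves-≡ (sym (lookup-outsider w Mw))

    data InBlock (p : Fin Rep.size) (w : Fin k) : Set where
      member : Rep.at p ≡ m₀ → M w ≡ true → InBlock p w
      itself : w ≡ Rep.at p → InBlock p w

    ∈-block⁻ : ∀ p {x} → x ∈ leaves (lookup children p) → ∃ λ w → x ∈ leaves (G w) × InBlock p w
    ∈-block⁻ p r = go (∈-leaves-≡ (Vec.lookup∘tabulate (block G) p) r)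
      where
      go : ∀ {x} → x ∈ leaves (block G p) → ∃ λ w → x ∈ leaves (G w) × InBlock p w
      go r with Rep.at p Fin.≟ m₀
      ... | yes e with q , r′ ← ∈-leavesV⁻ factorChildren r =
        Mem.at q , ∈-leaves-≡ (lookup-factorChildren q) r′ , member e (Mem.at-∈ q)
      go r | no _ = Rep.at p , r , itself refl

    split-leaves⊆ : ∀ {x} → x ∈ leaves (split G) → x ∈ leavesV cs
    split-leaves⊆ r with p , r′ ← ∈-leavesV⁻ children r with w , r″ , _ ← ∈-block⁻ p r′ =
      ∈-leavesV⁺ cs w r″

    split-leaves⊇ : ∀ {x} → x ∈ leavesV cs → x ∈ leaves (split G)
    split-leaves⊇ r with w , r′ ← ∈-leavesV⁻ cs r | M w in Mw
    ... | true = ∈-leavesV⁺ children p₀ (∈-p₀ Mw r′)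
    ... | false = ∈-leavesV⁺ children (outsider w Mw) (∈-outsider Mw r′)

    DisjointChildren-factor : DisjointChildren factorChildren
    DisjointChildren-factor q q′ r r′ =
      Mem.at-injective (D _ _ (∈-leaves-≡ (lookup-factorChildren q) r)
                              (∈-leaves-≡ (lookup-factorChildren q′) r′))

    InBlock-unique : ∀ {p p′ w} → InBlock p w → InBlock p′ w → p ≡ p′
    InBlock-unique (member e _) (member e′ _) = Rep.at-injective (trans e (sym e′))
    InBlock-unique (itself e) (itself e′) = Rep.at-injective (trans (sym e) e′)
    InBlock-unique {p} {p′} (member e Mw) (itself refl) with Rep.at-∈ p′
    ... | inj₁ Mw′ = ⊥-elim (M-conflict Mw Mw′)
    ... | inj₂ e′ = Rep.at-injective (trans e (sym e′))
    InBlock-unique {p} {p′} (itself refl) (member e′ Mw) with Rep.at-∈ p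
    ... | inj₁ Mw′ = ⊥-elim (M-conflict Mw Mw′)
    ... | inj₂ e = Rep.at-injective (trans e (sym e′))

    DisjointChildren-split : DisjointChildren children
    DisjointChildren-split p p′ r r′
      with w , rw , b ← ∈-block⁻ p r | w′ , rw′ , b′ ← ∈-block⁻ p′ r′
      with refl ← D w w′ rw rw′ = InBlock-unique b b′

    WellLabelled-factorNode : WellLabelled (factorNode G)
    WellLabelled-factorNode =
      wf-node (gr factor) factorChildren 2≤#M sorted (Allₚ.lookup⁻ (proj₁ ∘ wlᵢ)) ,
      Unique-leavesV⁺ factorChildren (proj₂ ∘ wlᵢ) DisjointChildren-factor
      where
      wlᵢ : ∀ q → WellLabelled (lookup factorChildren q)
      wlᵢ q = subst WellLabelled (sym (lookup-factorChildren q)) (WellLabelled-child wl (Mem.at q))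
      sorted : SortedChildren factorChildren
      sorted q q′ q<q′ rewrite lookup-factorChildren q | lookup-factorChildren q′ =
        WF-sorted (proj₁ wl) _ _ (Mem.at-mono q<q′)

    minLeaf-factorNode : minLeaf (factorNode G) ≡ minLeaf (G m₀)
    minLeaf-factorNode =
      minList-unique (leaves (factorNode G)) (∈-leaves-≡ lookup-p₀ (∈-p₀ Mm₀ least∈))
        λ r → let q , r′ = ∈-leavesV⁻ factorChildren r in
          ℕ.≤-trans (SortedChildren-≤ cs (WF-sorted (proj₁ wl)) (m₀-least _ (Mem.at-∈ q)))
                    (minList-≤ _ (∈-leaves-≡ (lookup-factorChildren q) r′))
      where
      least∈ : minLeaf (G m₀) ∈ leaves (G m₀)
      least∈ = minList-∈ _ (proj₂ (WF⇒nonempty (proj₁ (WellLabelled-child wl m₀))))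

    minLeaf-block : ∀ p → minLeaf (lookup children p) ≡ minLeaf (G (Rep.at p))
    minLeaf-block p rewrite Vec.lookup∘tabulate (block G) p with Rep.at p Fin.≟ m₀
    ... | yes e = trans minLeaf-factorNode (cong (minLeaf ∘ G) (sym e))
    ... | no _ = refl

    WellLabelled-block : ∀ p → WellLabelled (lookup children p)
    WellLabelled-block p rewrite Vec.lookup∘tabulate (block G) p with Rep.at p Fin.≟ m₀
    ... | yes _ = WellLabelled-factorNode
    ... | no _ = WellLabelled-child wl (Rep.at p)

    WellLabelled-split : WellLabelled (split G)
    WellLabelled-split =
      wf-node (gr quotient) children 2≤#R sorted (Allₚ.lookup⁻ (proj₁ ∘ WellLabelled-block)) ,
      Unique-leavesV⁺ children (proj₂ ∘ WellLabelled-block) DisjointChildren-split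
      where
      sorted : SortedChildren children
      sorted p p′ p<p′ = subst₂ _<_ (sym (minLeaf-block p)) (sym (minLeaf-block p′))
                           (WF-sorted (proj₁ wl) _ _ (Rep.at-mono p<p′))

    treeAdj-p₀ : ∀ {w w′ a b} → M w ≡ true → M w′ ≡ true → a ∈ leaves (G w) → b ∈ leaves (G w′) →
                 treeAdj (split G) a b ≡ treeAdj (factorNode G) a b
    treeAdj-p₀ {a = a} {b} Mw Mw′ ra rb =
      trans (treeAdj-node-same (gr quotient) children DisjointChildren-split p₀
               (∈-p₀ Mw ra) (∈-p₀ Mw′ rb))
            (cong (λ t → treeAdj t a b) lookup-p₀)

    split-adj-same : ∀ w {a b} → a ∈ leaves (G w) → b ∈ leaves (G w) →
                     treeAdj (split G) a b ≡ treeAdj (G w) a b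
    split-adj-same w {a} {b} ra rb with M w in Mw
    ... | true with q , refl ← Mem.at-onto w Mw = begin
      treeAdj (split G) a b
        ≡⟨ treeAdj-p₀ Mw Mw ra rb ⟩
      treeAdj (factorNode G) a b
        ≡⟨ treeAdj-node-same (gr factor) factorChildren DisjointChildren-factor q
             (∈-factorChild q ra) (∈-factorChild q rb) ⟩
      treeAdj (lookup factorChildren q) a b
        ≡⟨ cong (λ t → treeAdj t a b) (lookup-factorChildren q) ⟩
      treeAdj (G (Mem.at q)) a b ∎
      where open ≡-Reasoning
    ... | false =
      trans (treeAdj-node-same (gr quotient) children DisjointChildren-split (outsider w Mw)
               (∈-outsider Mw ra) (∈-outsider Mw rb))
            (cong (λ t → treeAdj t a b) (lookup-outsider w Mw))

    adj-module : ∀ {y z w} → M y ≡ true → M z ≡ true → M w ≡ false → adj H y w ≡ adj H z w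
    adj-module {y} {z} {w} My Mz Mw = trans (adj-sym H y w) (trans (mod w Mw y z My Mz) (adj-sym H w z))

    split-adj-diff : ∀ {w w′ a b} → a ∈ leaves (G w) → b ∈ leaves (G w′) → w ≢ w′ →
                     treeAdj (split G) a b ≡ adj H w w′
    split-adj-diff {w} {w′} ra rb w≢w′ with M w in Mw | M w′ in Mw′
    ... | true | true with q , refl ← Mem.at-onto w Mw | q′ , refl ← Mem.at-onto w′ Mw′ =
      trans (treeAdj-p₀ Mw Mw′ ra rb)
            (treeAdj-node-diff (gr factor) factorChildren DisjointChildren-factor
               (∈-factorChild q ra) (∈-factorChild q′ rb) (w≢w′ ∘ cong Mem.at))
    ... | true | false =
      trans (treeAdj-node-diff (gr quotient) children DisjointChildren-split
               (∈-p₀ Mw ra) (∈-outsider Mw′ rb) (outsider≢p₀ Mw′ ∘ sym))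
            (trans (cong₂ (adj H) at-p₀ (at-outsider w′ Mw′)) (adj-module Mm₀ Mw Mw′))
    ... | false | true =
      trans (treeAdj-node-diff (gr quotient) children DisjointChildren-split
               (∈-outsider Mw ra) (∈-p₀ Mw′ rb) (outsider≢p₀ Mw))
            (trans (cong₂ (adj H) (at-outsider w Mw) at-p₀) (mod w Mw m₀ w′ Mm₀ Mw′))
    ... | false | false =
      trans (treeAdj-node-diff (gr quotient) children DisjointChildren-split
               (∈-outsider Mw ra) (∈-outsider Mw′ rb) (w≢w′ ∘ outsider-injective))
            (cong₂ (adj H) (at-outsider w Mw) (at-outsider w′ Mw′))
      where
      outsider-injective : outsider w Mw ≡ outsider w′ Mw′ → w ≡ w′
      outsider-injective e = trans (sym (at-outsider w Mw)) (trans (cong Rep.at e) (at-outsider w′ Mw′))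

    split-≈ : node d cs ≈ split G
    split-≈ = ≈-node-intro d cs D (split G) split-leaves⊇ split-leaves⊆ split-adj-same split-adj-diff

  2≤k : 2 ≤ k
  2≤k = distinct⇒2≤ u≢v

  τ-SubstTreeOf : SubstTreeOf τ H
  τ-SubstTreeOf = subst (λ t → SubstTreeOf t H) (split-cong lookup-leafVec)
    (SubstTreeOf-resp-≈ {G = H} (leafVec-SubstTreeOf d H 2≤k λ _ _ _ → refl) split-≈ WellLabelled-split)
    where open OnChildren (leafVec k) (WellLabelled-leafVec d 2≤k)

  split-Inflation : ∀ cs → Inflation (node d cs) (split (lookup cs))
  split-Inflation cs = subst (Inflation (node d cs)) (graft-τ cs) (here d cs τ τ-SubstTreeOf)

ExpandableRoot : ∀ {k} → Deco k → Set
ExpandableRoot {k} d = (cs : Vec Tree k) → WellLabelled (node d cs) → All ExpandedShape cs →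
                       Expansion (node d cs)

ExpandableRoots : ℕ → Set
ExpandableRoots k = (d : Deco k) → ExpandableRoot d

Expansion-split : ∀ {k} → (∀ {m} → m < k → ExpandableRoots m) → ∀ (d : Deco k) M →
                  NonTrivialModule (decoGraph d) M → ExpandableRoot d
Expansion-split rec d M (mod , (_ , _ , u≢v , Mu , Mv) , _ , Mx) cs wl exs =
  Expansion-prepend (split-Inflation cs ◅ factor-inflations)
    (≈-trans split-≈ (node-cong (gr quotient) children≈)) quotientExpansion
  where
  open Split d M mod u≢v Mu Mv Mx
  open OnChildren cs wl
  factorExpansion : Expansion (factorNode G)
  factorExpansion = rec #M<k (gr factor) factorChildren WellLabelled-factorNode
    (Allₚ.lookup⁻ λ q → subst ExpandedShape (sym (lookup-factorChildren q)) (Allₚ.lookup⁺ exs (Mem.at q)))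
  module F = Expansion factorExpansion
  children′ : Vec Tree Rep.size
  children′ = children [ p₀ ]≔ F.tree
  factor-inflations : Inflations (split G) (node (gr quotient) children′)
  factor-inflations = Inflations-at (gr quotient) children p₀
    (subst (λ t → Inflations t F.tree) (sym lookup-p₀) F.inflations)
  children≈ : children ≈ᵥ children′
  children≈ = ≈ᵥ-update children p₀ (≈-trans (≈-reflexive lookup-p₀) F.≈tree)
  quotientExpansion : Expansion (node (gr quotient) children′)
  quotientExpansion = rec #R<k (gr quotient) children′
    (WellLabelled-node-cong (gr quotient) WellLabelled-split children≈
       (All-update⁺ children p₀ (λ p _ → WellLabelled-block p) F.wellLabelled))
    (All-update⁺ children p₀
       (λ p p≢p₀ → subst ExpandedShape (sym (lookup-other p≢p₀)) (Allₚ.lookup⁺ exs _))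
       F.expanded)

Expansion-indecomposable : ∀ {k} (d : Deco k) → ¬ ∃ (NonTrivialModule (decoGraph d)) → ExpandableRoot d
Expansion-indecomposable d ¬ntm cs@(_ ∷ _ ∷ []) wl exs = Expansion-binary d cs wl exs
Expansion-indecomposable (gr H) ¬ntm cs@(_ ∷ _ ∷ _ ∷ _) wl exs =
  Expansion-refl (ex-prime H cs (¬NonTrivialModule⇒Prime H (s≤s (s≤s (s≤s z≤n))) ¬ntm) exs) wl
Expansion-indecomposable ⊕ ¬ntm (_ ∷ _ ∷ _ ∷ _) _ _ =
  ⊥-elim (¬ntm (firstTwo , every-set-module-complete firstTwo , NonTrivial-firstTwo))
Expansion-indecomposable ⊖ ¬ntm (_ ∷ _ ∷ _ ∷ _) _ _ =
  ⊥-elim (¬ntm (firstTwo , every-set-module-edgeless firstTwo , NonTrivial-firstTwo))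
Expansion-indecomposable d ¬ntm [] (wf-node _ _ () _ _ , _) _
Expansion-indecomposable d ¬ntm (_ ∷ []) (wf-node _ _ (s≤s ()) _ _ , _) _

rootExpansion : ∀ k → ExpandableRoots k
rootExpansion = <-rec ExpandableRoots λ k rec d → case nonTrivialModule? (decoGraph d) of λ where
  (yes (M , ntm)) → Expansion-split rec d M ntm
  (no ¬ntm) → Expansion-indecomposable d ¬ntm

record ChildrenExpansion {k} (cs : Vec Tree k) : Set where
  field
    trees : Vec Tree k
    inflations : ChildInflations cs trees
    ≈trees : cs ≈ᵥ trees
    wellLabelled : All WellLabelled trees
    expanded : All ExpandedShape trees

mutual
  expansion : ∀ t → WellLabelled t → Expansion t
  expansion (leaf a) wl = Expansion-refl (ex-leaf a) wl
  expansion (node d cs) wl =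
    Expansion-prepend (Inflations-node d inflations) (node-cong d ≈trees)
      (rootExpansion _ d trees (WellLabelled-node-cong d wl ≈trees wellLabelled) expanded)
    where open ChildrenExpansion (childrenExpansion cs (Allₚ.lookup⁻ (WellLabelled-child wl)))

  childrenExpansion : ∀ {k} (cs : Vec Tree k) → All WellLabelled cs → ChildrenExpansion cs
  childrenExpansion [] [] = record { inflations = ε ; ≈trees = [] ; wellLabelled = [] ; expanded = [] }
  childrenExpansion (c ∷ cs) (wl ∷ wls) = record
    { inflations = ChildInflations-head cs E.inflations ◅◅ ChildInflations-tail E.tree Es.inflations
    ; ≈trees = E.≈tree ∷ Es.≈trees
    ; wellLabelled = E.wellLabelled ∷ Es.wellLabelled
    ; expanded = E.expanded ∷ Es.expanded
    }
    where
    module E = Expansion (expansion c wl)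
    module Es = ChildrenExpansion (childrenExpansion cs wls)

lemma2p25 : ∀ {n} (G : LGraph n) (t : Tree) → SubstTreeOf t G →
    Σ Tree (λ t′ → Inflations t t′ × ExpandedTreeOf t′ G)
lemma2p25 G t sub = tree , inflations , (SubstTreeOf-resp-≈ {G = G} sub ≈tree wellLabelled , expanded)
  where open Expansion (expansion t (SubstTreeOf⇒WellLabelled {G = G} sub))
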